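{- Let $U=\{v_1,\dots,v_n\}$ be a unit interval order with $n$ elements, and let $m_n^U$ denote the coefficient of the monomial $\prod_{j=1}^n v_j$ in $\rho_{\mathrm{inc}(U)}(m_{(n)})$. Then $m_n^U$ is divisible by $n$.
   Context: A unit interval order (UIO) is a finite set $U\subset\mathbb{R}$ with $u\succ w$ iff $u\ge w+1$; $\mathrm{inc}(U)$ is the graph on $U$ in which $u,w$ are adjacent iff $|u-w|<1$. Stanley's $G$-homomorphism: for a finite graph $G$ with vertices $v_1,\dots,v_n$ regarded as commuting variables, $\rho_G:\Lambda\to\mathbb{R}[v_1,\dots,v_n]$ is the ring homomorphism from the ring of symmetric functions with $\rho_G(e_i)=\sum_S\prod_{v\in S}v$, summed over $i$-element independent sets $S$ of $G$. $m_{(n)}=\sum_i x_i^n$ is the monomial symmetric function of the one-part partition $(n)$.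
   Formalization: The elements of the unit interval order U are rational numbers rather than arbitrary reals. -}

module Defs where

open import Data.Bool using (Bool; true; false; _∧_; not; if_then_else_)
open import Data.Nat as ℕ using (ℕ; zero; suc)
open import Data.Integer as ℤ using (ℤ; +_)
open import Data.Rational as ℚ using (ℚ; 1ℚ; ∣_∣)
open import Data.Rational.Properties as ℚP using (_<?_)
open import Data.Fin as Fin using (Fin)
open import Data.Fin.Properties as FinP using ()
open import Data.Vec as Vec using (Vec; []; _∷_; lookup; replicate)
open import Data.Vec.Properties as VecP using ()
open import Data.List as List using (List; []; _∷_; _++_; map; concatMap; foldr; allFin)
open import Data.Bool.ListAction using (and)
open import Data.Product using (_×_; _,_)
open import Relation.Nullary.Decidable using (⌊_⌋)

-- U = {v_1,...,v_n} given as an injective enumeration v : Fin n → ℚ.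
Distinct : {n : ℕ} → Vec ℚ n → Set
Distinct {n} U = (i j : Fin n) → lookup U i ≡ lookup U j → i ≡ j
  where open import Relation.Binary.PropositionalEquality using (_≡_)

-- adjacency in inc(U): u ≠ w (as vertices) and |u - w| < 1
incAdj : {n : ℕ} → Vec ℚ n → Fin n → Fin n → Bool
incAdj U i j = not ⌊ i Fin.≟ j ⌋ ∧ ⌊ ∣ lookup U i ℚ.- lookup U j ∣ <? 1ℚ ⌋

allSubsets : (n : ℕ) → List (Vec Bool n)
allSubsets zero = [] ∷ []
allSubsets (suc n) = concatMap (λ S → (false ∷ S) ∷ (true ∷ S) ∷ []) (allSubsets n)

size : {n : ℕ} → Vec Bool n → ℕ
size [] = 0
size (false ∷ S) = size S
size (true ∷ S) = suc (size S)

isIndependent : {n : ℕ} → Vec ℚ n → Vec Bool n → Bool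
isIndependent {n} U S =
  and (concatMap (λ i → map (λ j → not (lookup S i ∧ lookup S j ∧ incAdj U i j))
                              (allFin n))
                 (allFin n))

-- Polynomials in commuting variables v_1..v_n with integer coefficients,
-- represented as formal sums of terms (coefficient, exponent vector).

Poly : ℕ → Set
Poly n = List (ℤ × Vec ℕ n)

_⊕_ : {n : ℕ} → Poly n → Poly n → Poly n
p ⊕ q = p ++ q

_⊗_ : {n : ℕ} → Poly n → Poly n → Poly n
p ⊗ q = concatMap (λ { (a , α) → map (λ { (b , β) → (a ℤ.* b , Vec.zipWith ℕ._+_ α β) }) q }) p

scale : {n : ℕ} → ℤ → Poly n → Poly n
scale c p = map (λ { (a , α) → (c ℤ.* a , α) }) p

coeff : {n : ℕ} → Vec ℕ n → Poly n → ℤ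
coeff α p = foldr (λ { (a , β) acc → if ⌊ VecP.≡-dec ℕ._≟_ α β ⌋ then a ℤ.+ acc else acc }) (+ 0) p

monoOf : {n : ℕ} → Vec Bool n → Vec ℕ n
monoOf = Vec.map (λ b → if b then 1 else 0)

-- Stanley's G-homomorphism for G = inc(U)

ρe : {n : ℕ} → Vec ℚ n → ℕ → Poly n
ρe {n} U i =
  List.map (λ S → (+ 1 , monoOf S))
    (List.filter (λ S → Relation.Nullary.Decidable.T? (isIndependent U S ∧ ⌊ size S ℕ.≟ i ⌋))
                 (allSubsets n))
  where import Relation.Nullary.Decidable

sgn : ℕ → ℤ
sgn zero = + 1
sgn (suc k) = ℤ.- sgn k

-- m_(k) = p_k (power sum) expressed in Λ = ℤ[e_1,e_2,...] by Newton's identities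
--   p_k = Σ_{i=1}^{k-1} (-1)^{i-1} e_i p_{k-i} + (-1)^{k-1} k e_k ,
-- and ρ applied (ρ is a ring homomorphism).
-- ρpRev U k = [ρ(p_k), ρ(p_{k-1}), ..., ρ(p_1)]
ρpRev : {n : ℕ} → Vec ℚ n → ℕ → List (Poly n)
ρpRev U zero = []
ρpRev U (suc k) = newton ∷ prev
  where
    prev = ρpRev U k
    -- prev = [ρ p_k, ..., ρ p_1]; pair ρ p_{k+1-i} with e_i for i = 1..k
    sumTerms : ℕ → List (Poly _) → Poly _
    sumTerms i [] = []
    sumTerms i (p ∷ ps) = scale (sgn (ℕ.pred i)) (ρe U i ⊗ p) ⊕ sumTerms (suc i) ps
    newton = sumTerms 1 prev ⊕ scale (sgn k ℤ.* + suc k) (ρe U (suc k))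

-- ρ_{inc(U)}(m_(k))  (for k ≥ 1)
ρm : {n : ℕ} → Vec ℚ n → ℕ → Poly n
ρm U k with ρpRev U k
... | [] = []
... | p ∷ _ = p

mU : {n : ℕ} → Vec ℚ n → ℤ
mU {n} U = coeff (replicate n 1) (ρm U n)

{-# OPTIONS --safe #-}

-- Evaluate in Dual n = ℤ[ε₁, …, εₙ]/(ε₁², …, εₙ²), where m_n^U becomes the coefficient of the
-- top monomial ε₁ ⋯ εₙ, and let θ be the Euler derivation (θ multiplies a monomial by its degree).
-- With F = ∑ᵢ (-1)ⁱ ρ(eᵢ) and P = ∑ₖ₌₁ⁿ ρ(pₖ), Newton's identities give P F = -θ F, since every
-- product of total degree above n vanishes. F has constant term 1, hence an inverse G, and ρ(pₖ)
-- is homogeneous of degree k, so the top coefficient of ρ(pₙ) is that of -θ F · G. Writing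
-- F = a + b εₙ, the εₙ-part of θ F · G is θ c + c with c = b a⁻¹, and the top coefficient of
-- θ c + c is (n - 1) t + t = n t, where t is the top coefficient of c.

module Submission where

open import Defs
open import Data.Nat using (ℕ; _≤_)
open import Data.Integer using (+_)
open import Data.Integer.Divisibility using (_∣_)
open import Data.Rational using (ℚ)
open import Data.Vec using (Vec)

open import Algebra.Bundles using (CommutativeRing)
open import Algebra.Solver.Ring.AlmostCommutativeRing
  using (AlmostCommutativeRing; fromCommutativeRing; _-Raw-AlmostCommutative⟶_)
open import Algebra.Structures using (IsCommutativeRing)
open import Data.Bool using (Bool; true; false; T; _∧_)
import Data.Bool.Properties as Bool
open import Data.Integer as ℤ using (ℤ; 0ℤ; 1ℤ)
import Data.Integer.Divisibility.Signed as DivS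
open DivS using (∣⇒∣ᵤ; ∣m⇒∣-m)
import Data.Integer.Properties as ℤ
open import Data.List as List using (List; []; _∷_; _++_)
open import Data.List.Relation.Unary.All as All using (All; []; _∷_)
open import Data.List.Relation.Unary.All.Properties using (all-filter)
open import Data.Maybe as Maybe using (Maybe)
open import Data.Nat as ℕ using (zero; suc)
open import Data.Nat.Induction using (<-rec)
import Data.Nat.Properties as ℕ
open import Data.Product using (_×_; _,_; proj₁; proj₂; Σ-syntax)
open import Data.Vec as Vec using ([]; _∷_; replicate; zipWith)
import Data.Vec.Properties as Vec
open import Function using (_∘_)
open import Relation.Binary.Consequences using (dec⇒weaklyDec)
open import Function.Bundles using (Equivalence)
open import Level using (Level; 0ℓ)
open import Relation.Binary.PropositionalEquality
  using (_≡_; _≢_; refl; sym; trans; cong; cong₂; subst; isEquivalence; module ≡-Reasoning)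
open import Relation.Nullary using (yes; no; contradiction)
open import Relation.Nullary.Decidable using (toWitness; T?; ⌊_⌋)

module CommutativeRingTheory {c ℓ : Level} (R : CommutativeRing c ℓ) where

  open CommutativeRing R hiding (zero; trans) renaming (refl to ≈-refl; sym to ≈-sym)
  open import Relation.Binary.Reasoning.Setoid setoid

  open import Algebra.Solver.Ring.NaturalCoefficients.Default commutativeSemiring
    using (solve; _:+_; _:*_; _:=_)

  +≈0⇒*≈* : ∀ {x y z w} → x + y ≈ 0# → z + w ≈ 0# → x * z ≈ y * w
  +≈0⇒*≈* {x} {y} {z} {w} x+y≈0 z+w≈0 = begin
    x * z                  ≈⟨ +-identityʳ _ ⟨
    x * z + 0#             ≈⟨ +-congˡ (zeroʳ y) ⟨
    x * z + y * 0#         ≈⟨ +-congˡ (*-congˡ z+w≈0) ⟨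
    x * z + y * (z + w)    ≈⟨ solve 4 (λ x y z w → x :* z :+ y :* (z :+ w) := (x :+ y) :* z :+ y :* w) ≈-refl x y z w ⟩
    (x + y) * z + y * w    ≈⟨ +-congʳ (*-congʳ x+y≈0) ⟩
    0# * z + y * w         ≈⟨ +-congʳ (zeroˡ z) ⟩
    0# + y * w             ≈⟨ +-identityˡ _ ⟩
    y * w                  ∎

  inverse-cross-swap : ∀ {a a′ b b′ u v} → a * a′ ≈ 1# →
                    a * b′ + b * a′ ≈ 0# → u * a′ + a * v ≈ 0# → u * b′ ≈ b * v
  inverse-cross-swap {a} {a′} {b} {b′} {u} {v} aa′≈1 h₁ h₂ = begin
    u * b′                ≈⟨ *-identityʳ _ ⟨
    u * b′ * 1#           ≈⟨ *-congˡ aa′≈1 ⟨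
    u * b′ * (a * a′)     ≈⟨ solve 4 (λ u b′ a a′ → u :* b′ :* (a :* a′) := (a :* b′) :* (u :* a′)) ≈-refl u b′ a a′ ⟩
    (a * b′) * (u * a′)   ≈⟨ +≈0⇒*≈* h₁ h₂ ⟩
    (b * a′) * (a * v)    ≈⟨ solve 4 (λ b a′ a v → (b :* a′) :* (a :* v) := b :* v :* (a :* a′)) ≈-refl b a′ a v ⟩
    b * v * (a * a′)      ≈⟨ *-congˡ aa′≈1 ⟩
    b * v * 1#            ≈⟨ *-identityʳ _ ⟩
    b * v                 ∎

  partialSum : (ℕ → Carrier) → ℕ → Carrier
  partialSum a zero    = a zero
  partialSum a (suc k) = partialSum a k + a (suc k)

  partialSum⁺ : (ℕ → Carrier) → ℕ → Carrier
  partialSum⁺ b zero    = 0#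
  partialSum⁺ b (suc k) = partialSum⁺ b k + b (suc k)

  -- conv a b i k = ∑_{j=1}^{k} a (i + k - j) * b j
  conv : (ℕ → Carrier) → (ℕ → Carrier) → ℕ → ℕ → Carrier
  conv a b i zero    = 0#
  conv a b i (suc k) = a i * b (suc k) + conv a b (suc i) k

  conv-partialSum-shift : ∀ a b i k →
    conv (partialSum a) b (suc i) k ≈ conv (partialSum a) b i k + conv a b (suc i) k
  conv-partialSum-shift a b i zero    = ≈-sym (+-identityʳ 0#)
  conv-partialSum-shift a b i (suc k) = begin
    (A i + a (suc i)) * b (suc k) + conv A b (suc (suc i)) k
      ≈⟨ +-congˡ (conv-partialSum-shift a b (suc i) k) ⟩
    (A i + a (suc i)) * b (suc k) + (conv A b (suc i) k + conv a b (suc (suc i)) k)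
      ≈⟨ solve 5 (λ x y z u v → (x :+ y) :* z :+ (u :+ v) := (x :* z :+ u) :+ (y :* z :+ v)) ≈-refl
                 (A i) (a (suc i)) (b (suc k)) (conv A b (suc i) k) (conv a b (suc (suc i)) k) ⟩
    (A i * b (suc k) + conv A b (suc i) k) + (a (suc i) * b (suc k) + conv a b (suc (suc i)) k) ∎
    where
    A : ℕ → Carrier
    A = partialSum a

  conv-partialSum : ∀ a b k →
    conv (partialSum a) b 0 (suc k) ≈ conv (partialSum a) b 0 k + conv a b 0 (suc k)
  conv-partialSum a b k = begin
    a 0 * b (suc k) + conv A b 1 k                     ≈⟨ +-congˡ (conv-partialSum-shift a b 0 k) ⟩
    a 0 * b (suc k) + (conv A b 0 k + conv a b 1 k)
      ≈⟨ solve 3 (λ x y z → x :+ (y :+ z) := y :+ (x :+ z)) ≈-refl (a 0 * b (suc k)) (conv A b 0 k) (conv a b 1 k) ⟩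
    conv A b 0 k + (a 0 * b (suc k) + conv a b 1 k)    ∎
    where
    A : ℕ → Carrier
    A = partialSum a

  conv-constantˡ : ∀ a b z i k → (∀ i′ j → i′ ℕ.+ suc j ≡ i ℕ.+ k → a i′ * b (suc j) ≈ z * b (suc j)) →
                   conv a b i k ≈ z * partialSum⁺ b k
  conv-constantˡ a b z i zero    _ = ≈-sym (zeroʳ z)
  conv-constantˡ a b z i (suc k) h = begin
    a i * b (suc k) + conv a b (suc i) k          ≈⟨ +-cong (h i k refl) (conv-constantˡ a b z (suc i) k h′) ⟩
    z * b (suc k) + z * partialSum⁺ b k           ≈⟨ solve 3 (λ z x y → z :* x :+ z :* y := z :* (y :+ x)) ≈-refl z (b (suc k)) (partialSum⁺ b k) ⟩
    z * (partialSum⁺ b k + b (suc k))             ∎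
    where
    h′ : ∀ i′ j → i′ ℕ.+ suc j ≡ suc i ℕ.+ k → a i′ * b (suc j) ≈ z * b (suc j)
    h′ i′ j eq = h i′ j (trans eq (sym (ℕ.+-suc i k)))

-- Square-free polynomials

-- (a , b) : Dual (suc m) stands for a + b εₘ₊₁, so Dual m is ℤ[ε₁, …, εₘ] / (ε₁², …, εₘ²).
Dual : ℕ → Set
Dual zero    = ℤ
Dual (suc m) = Dual m × Dual m

infixl 6 _+_
infixl 7 _*_
infix  8 -_

fromℤ : ∀ {m} → ℤ → Dual m
fromℤ {zero}  c = c
fromℤ {suc m} c = fromℤ c , fromℤ 0ℤ

0# 1# : ∀ {m} → Dual m
0# = fromℤ 0ℤ
1# = fromℤ 1ℤ

_+_ : ∀ {m} → Dual m → Dual m → Dual m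
_+_ {zero}  = ℤ._+_
_+_ {suc m} (a , b) (c , d) = a + c , b + d

_*_ : ∀ {m} → Dual m → Dual m → Dual m
_*_ {zero}  = ℤ._*_
_*_ {suc m} (a , b) (c , d) = a * c , a * d + b * c

-_ : ∀ {m} → Dual m → Dual m
-_ {zero}  = ℤ.-_
-_ {suc m} (a , b) = - a , - b

dual-isCommutativeRing : ∀ m → IsCommutativeRing _≡_ (_+_ {m}) _*_ -_ 0# 1#
dual-isCommutativeRing zero    = ℤ.+-*-isCommutativeRing
dual-isCommutativeRing (suc m) = record
  { isRing = record
    { +-isAbelianGroup = record
      { isGroup = record
        { isMonoid = record
          { isSemigroup = record
            { isMagma = record { isEquivalence = isEquivalence ; ∙-cong = cong₂ _+_ }
            ; assoc   = λ (a , b) (c , d) (e , f) → cong₂ _,_ (+-assoc a c e) (+-assoc b d f)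
            }
          ; identity = (λ (a , b) → cong₂ _,_ (+-identityˡ a) (+-identityˡ b))
                     , (λ (a , b) → cong₂ _,_ (+-identityʳ a) (+-identityʳ b))
          }
        ; inverse = (λ (a , b) → cong₂ _,_ (-‿inverseˡ a) (-‿inverseˡ b))
                  , (λ (a , b) → cong₂ _,_ (-‿inverseʳ a) (-‿inverseʳ b))
        ; ⁻¹-cong = cong -_
        }
      ; comm = λ (a , b) (c , d) → cong₂ _,_ (+-comm a c) (+-comm b d)
      }
    ; *-cong     = cong₂ _*_
    ; *-assoc    = λ (a , b) (c , d) (e , f) → cong₂ _,_ (*-assoc a c e)
        (solve 6 (λ a b c d e f → a :* c :* f :+ (a :* d :+ b :* c) :* e := a :* (c :* f :+ d :* e) :+ b :* (c :* e))
               refl a b c d e f)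
    ; *-identity = (λ (a , b) → cong₂ _,_ (*-identityˡ a)
                     (solve 2 (λ a b → con 1 :* b :+ con 0 :* a := b) refl a b))
                 , (λ (a , b) → cong₂ _,_ (*-identityʳ a)
                     (solve 2 (λ a b → a :* con 0 :+ b :* con 1 := b) refl a b))
    ; distrib    = (λ (a , b) (c , d) (e , f) → cong₂ _,_ (distribˡ a c e)
                     (solve 6 (λ a b c d e f → a :* (d :+ f) :+ b :* (c :+ e) := (a :* d :+ b :* c) :+ (a :* f :+ b :* e)) refl a b c d e f))
                 , (λ (a , b) (c , d) (e , f) → cong₂ _,_ (distribʳ a c e)
                     (solve 6 (λ a b c d e f → (c :+ e) :* b :+ (d :+ f) :* a := (c :* b :+ d :* a) :+ (e :* b :+ f :* a)) refl a b c d e f))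
    }
  ; *-comm = λ (a , b) (c , d) → cong₂ _,_ (*-comm a c)
      (solve 4 (λ a b c d → a :* d :+ b :* c := c :* b :+ d :* a) refl a b c d)
  }
  where
  base : CommutativeRing 0ℓ 0ℓ
  base = record { isCommutativeRing = dual-isCommutativeRing m }
  open CommutativeRing base using (+-assoc; +-comm; +-identityˡ; +-identityʳ; -‿inverseˡ; -‿inverseʳ;
                                   *-assoc; *-comm; *-identityˡ; *-identityʳ; distribˡ; distribʳ)
  open import Algebra.Solver.Ring.NaturalCoefficients.Default (CommutativeRing.commutativeSemiring base)
    using (solve; _:+_; _:*_; _:=_; con)

dualRing : ℕ → CommutativeRing 0ℓ 0ℓ
dualRing m = record { isCommutativeRing = dual-isCommutativeRing m }

fromℤ-+ : ∀ {m} a b → fromℤ {m} (a ℤ.+ b) ≡ fromℤ a + fromℤ b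
fromℤ-+ {zero}  a b = refl
fromℤ-+ {suc m} a b = cong₂ _,_ (fromℤ-+ a b) (sym (+-identityʳ 0#))
  where open CommutativeRing (dualRing m) using (+-identityʳ)

fromℤ-* : ∀ {m} a b → fromℤ {m} (a ℤ.* b) ≡ fromℤ a * fromℤ b
fromℤ-* {zero}  a b = refl
fromℤ-* {suc m} a b = cong₂ _,_ (fromℤ-* a b)
  (sym (trans (cong₂ _+_ (zeroʳ (fromℤ a)) (zeroˡ (fromℤ b))) (+-identityʳ 0#)))
  where open CommutativeRing (dualRing m) using (+-identityʳ; zeroˡ; zeroʳ)

fromℤ-neg : ∀ {m} a → fromℤ {m} (ℤ.- a) ≡ - fromℤ a
fromℤ-neg {zero}  a = refl
fromℤ-neg {suc m} a = cong₂ _,_ (fromℤ-neg a) (sym ε⁻¹≈ε)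
  where open import Algebra.Properties.Group (CommutativeRing.+-group (dualRing m)) using (ε⁻¹≈ε)

module DualRing (m : ℕ) where

  open CommutativeRing (dualRing m) public
    using (+-assoc; +-identityˡ; +-identityʳ;
           *-assoc; *-comm; *-identityˡ; *-identityʳ; distribˡ; distribʳ; zeroˡ; zeroʳ)
  open import Algebra.Properties.Group (CommutativeRing.+-group (dualRing m)) public
    using (∙-cancelʳ; ε⁻¹≈ε)

  private
    almostCommutativeRing : AlmostCommutativeRing 0ℓ 0ℓ
    almostCommutativeRing = fromCommutativeRing (dualRing m)

    fromℤ-morphism : CommutativeRing.rawRing ℤ.+-*-commutativeRing -Raw-AlmostCommutative⟶ almostCommutativeRing
    fromℤ-morphism = record
      { ⟦_⟧ = fromℤ ; +-homo = fromℤ-+ ; *-homo = fromℤ-* ; -‿homo = fromℤ-neg ; 0-homo = refl ; 1-homo = refl }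

    fromℤ-≟ : ∀ a b → Maybe (fromℤ {m} a ≡ fromℤ b)
    fromℤ-≟ a b = Maybe.map (cong fromℤ) (dec⇒weaklyDec ℤ._≟_ a b)

  open import Algebra.Solver.Ring (CommutativeRing.rawRing ℤ.+-*-commutativeRing) almostCommutativeRing
    fromℤ-morphism fromℤ-≟ public
    using (solve; _:+_; _:*_; :-_; _:=_; con)

-- The Euler derivation and homogeneity

-- θ = ∑ᵢ εᵢ ∂/∂εᵢ
θ : ∀ {m} → Dual m → Dual m
θ {zero}  _       = 0ℤ
θ {suc m} (a , b) = θ a , θ b + b

θ-+ : ∀ {m} (x y : Dual m) → θ (x + y) ≡ θ x + θ y
θ-+ {zero}  _       _       = refl
θ-+ {suc m} (a , b) (c , d) = cong₂ _,_ (θ-+ a c) (begin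
  θ (b + d) + (b + d)        ≡⟨ cong (_+ (b + d)) (θ-+ b d) ⟩
  θ b + θ d + (b + d)        ≡⟨ solve 4 (λ x b y d → x :+ y :+ (b :+ d) := x :+ b :+ (y :+ d)) refl (θ b) b (θ d) d ⟩
  θ b + b + (θ d + d)        ∎)
  where open DualRing m; open ≡-Reasoning

θ-* : ∀ {m} (x y : Dual m) → θ (x * y) ≡ θ x * y + x * θ y
θ-* {zero}  x       y       = sym (cong (λ t → 0ℤ ℤ.+ t) (ℤ.*-zeroʳ x))
θ-* {suc m} (a , b) (c , d) = cong₂ _,_ (θ-* a c) (begin
  θ (a * d + b * c) + (a * d + b * c)
    ≡⟨ cong (_+ (a * d + b * c)) (trans (θ-+ (a * d) (b * c)) (cong₂ _+_ (θ-* a d) (θ-* b c))) ⟩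
  θ a * d + a * θ d + (θ b * c + b * θ c) + (a * d + b * c)
    ≡⟨ solve 8 (λ a b c d a′ b′ c′ d′ → a′ :* d :+ a :* d′ :+ (b′ :* c :+ b :* c′) :+ (a :* d :+ b :* c)
                                      := a′ :* d :+ (b′ :+ b) :* c :+ (a :* (d′ :+ d) :+ b :* c′))
             refl a b c d (θ a) (θ b) (θ c) (θ d) ⟩
  θ a * d + (θ b + b) * c + (a * (θ d + d) + b * θ c) ∎)
  where open DualRing m; open ≡-Reasoning

θ-neg : ∀ {m} (x : Dual m) → θ (- x) ≡ - θ x
θ-neg {zero}  _       = refl
θ-neg {suc m} (a , b) = cong₂ _,_ (θ-neg a)
  (trans (cong (_+ - b) (θ-neg b)) (solve 2 (λ x b → :- x :+ :- b := :- (x :+ b)) refl (θ b) b))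
  where open DualRing m

θ-fromℤ : ∀ {m} c → θ (fromℤ {m} c) ≡ 0#
θ-fromℤ {zero}  _ = refl
θ-fromℤ {suc m} c = cong₂ _,_ (θ-fromℤ c) (trans (cong (_+ 0#) (θ-fromℤ 0ℤ)) (+-identityʳ 0#))
  where open DualRing m

Homogeneous : ∀ {m} → ℕ → Dual m → Set
Homogeneous d x = θ x ≡ fromℤ (+ d) * x

module _ {m : ℕ} where
  open DualRing m
  open ≡-Reasoning

  homogeneous-0# : ∀ d → Homogeneous d (0# {m})
  homogeneous-0# d = trans (θ-fromℤ 0ℤ) (sym (zeroʳ _))

  homogeneous-1# : Homogeneous 0 (1# {m})
  homogeneous-1# = trans (θ-fromℤ 1ℤ) (sym (zeroˡ _))

  homogeneous-+ : ∀ {d} {x y : Dual m} → Homogeneous d x → Homogeneous d y → Homogeneous d (x + y)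
  homogeneous-+ {d} {x} {y} hx hy = begin
    θ (x + y)                   ≡⟨ θ-+ x y ⟩
    θ x + θ y                   ≡⟨ cong₂ _+_ hx hy ⟩
    fromℤ (+ d) * x + fromℤ (+ d) * y ≡⟨ distribˡ _ x y ⟨
    fromℤ (+ d) * (x + y)       ∎

  homogeneous-neg : ∀ {d} {x : Dual m} → Homogeneous d x → Homogeneous d (- x)
  homogeneous-neg {d} {x} hx = begin
    θ (- x)                ≡⟨ θ-neg x ⟩
    - θ x                  ≡⟨ cong -_ hx ⟩
    - (fromℤ (+ d) * x)    ≡⟨ solve 2 (λ s x → :- (s :* x) := s :* :- x) refl (fromℤ (+ d)) x ⟩
    fromℤ (+ d) * - x      ∎

  homogeneous-scale : ∀ {d} c {x : Dual m} → Homogeneous d x → Homogeneous d (fromℤ c * x)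
  homogeneous-scale {d} c {x} hx = begin
    θ (fromℤ c * x)                ≡⟨ θ-* (fromℤ c) x ⟩
    θ (fromℤ c) * x + fromℤ c * θ x ≡⟨ cong₂ (λ u v → u * x + fromℤ c * v) (θ-fromℤ c) hx ⟩
    0# * x + fromℤ c * (fromℤ (+ d) * x)
      ≡⟨ solve 3 (λ c s x → con 0ℤ :* x :+ c :* (s :* x) := s :* (c :* x)) refl (fromℤ c) (fromℤ (+ d)) x ⟩
    fromℤ (+ d) * (fromℤ c * x)    ∎

  homogeneous-* : ∀ {d e} {x y : Dual m} → Homogeneous d x → Homogeneous e y → Homogeneous (d ℕ.+ e) (x * y)
  homogeneous-* {d} {e} {x} {y} hx hy = begin
    θ (x * y)                              ≡⟨ θ-* x y ⟩
    θ x * y + x * θ y                      ≡⟨ cong₂ (λ u v → u * y + x * v) hx hy ⟩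
    fromℤ (+ d) * x * y + x * (fromℤ (+ e) * y)
      ≡⟨ solve 4 (λ s t x y → s :* x :* y :+ x :* (t :* y) := (s :+ t) :* (x :* y)) refl (fromℤ (+ d)) (fromℤ (+ e)) x y ⟩
    (fromℤ (+ d) + fromℤ (+ e)) * (x * y)  ≡⟨ cong (_* (x * y)) (fromℤ-+ (+ d) (+ e)) ⟨
    fromℤ (+ (d ℕ.+ e)) * (x * y)          ∎

module _ {m : ℕ} where
  open DualRing m
  open ≡-Reasoning

  homogeneous-const : ∀ {d} {a : Dual m} → Homogeneous d a → Homogeneous d (a , 0#)
  homogeneous-const {d} {a} ha = cong₂ _,_ ha (begin
    θ 0# + 0#                           ≡⟨ cong (_+ 0#) (θ-fromℤ 0ℤ) ⟩
    0# + 0#                             ≡⟨ solve 2 (λ s a → con 0ℤ :+ con 0ℤ := s :* con 0ℤ :+ con 0ℤ :* a) refl (fromℤ (+ d)) a ⟩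
    fromℤ (+ d) * 0# + 0# * a           ∎)

  homogeneous-ε : ∀ {d} {b : Dual m} → Homogeneous d b → Homogeneous (suc d) (0# , b)
  homogeneous-ε {d} {b} hb = cong₂ _,_ (homogeneous-0# (suc d)) (begin
    θ b + b                                     ≡⟨ cong (_+ b) hb ⟩
    fromℤ (+ d) * b + b                         ≡⟨ solve 2 (λ s b → s :* b :+ b := (con (+ 1) :+ s) :* b :+ con 0ℤ :* con 0ℤ) refl (fromℤ (+ d)) b ⟩
    (1# + fromℤ (+ d)) * b + 0# * 0#            ≡⟨ cong (λ s → s * b + 0# * 0#) (fromℤ-+ (+ 1) (+ d)) ⟨
    fromℤ (+ suc d) * b + 0# * 0#               ∎)

  homogeneous-proj₂ : ∀ {d} {a b : Dual m} → Homogeneous (suc d) (a , b) → Homogeneous d b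
  homogeneous-proj₂ {d} {a} {b} h = ∙-cancelʳ b _ _ (begin
    θ b + b                                     ≡⟨ cong proj₂ h ⟩
    fromℤ (+ suc d) * b + 0# * a                ≡⟨ cong (λ s → s * b + 0# * a) (fromℤ-+ (+ 1) (+ d)) ⟩
    (1# + fromℤ (+ d)) * b + 0# * a             ≡⟨ solve 3 (λ s a b → (con (+ 1) :+ s) :* b :+ con 0ℤ :* a := s :* b :+ b) refl (fromℤ (+ d)) a b ⟩
    fromℤ (+ d) * b + b                         ∎)

homogeneous-vanishes : ∀ {m d} {x : Dual m} → Homogeneous d x → m ℕ.< d → x ≡ 0#
homogeneous-vanishes {zero}  {suc d} {x} h _ = ℤ.*-cancelˡ-≡ (+ suc d) x 0ℤ (trans (sym h) (sym (ℤ.*-zeroʳ (+ suc d))))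
homogeneous-vanishes {suc m} {suc d} {a , b} h (ℕ.s≤s m<d) =
  cong₂ _,_ (homogeneous-vanishes (cong proj₁ h) (ℕ.m<n⇒m<1+n m<d))
            (homogeneous-vanishes (homogeneous-proj₂ h) m<d)

topCoeff : ∀ {m} → Dual m → ℤ
topCoeff {zero}  x       = x
topCoeff {suc m} (_ , b) = topCoeff b

topCoeff-+ : ∀ {m} (x y : Dual m) → topCoeff (x + y) ≡ topCoeff x ℤ.+ topCoeff y
topCoeff-+ {zero}  _       _       = refl
topCoeff-+ {suc m} (_ , b) (_ , d) = topCoeff-+ b d

topCoeff-0# : ∀ {m} → topCoeff (0# {m}) ≡ 0ℤ
topCoeff-0# {zero}  = refl
topCoeff-0# {suc m} = topCoeff-0# {m}

topCoeff-neg : ∀ {m} (x : Dual m) → topCoeff (- x) ≡ ℤ.- topCoeff x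
topCoeff-neg {zero}  _       = refl
topCoeff-neg {suc m} (_ , b) = topCoeff-neg b

topCoeff-scale : ∀ {m} c (x : Dual m) → topCoeff (fromℤ c * x) ≡ c ℤ.* topCoeff x
topCoeff-scale {zero}  c _       = refl
topCoeff-scale {suc m} c (a , b) = begin
  topCoeff (fromℤ c * b + 0# * a)            ≡⟨ topCoeff-+ (fromℤ c * b) (0# * a) ⟩
  topCoeff (fromℤ c * b) ℤ.+ topCoeff (0# * a) ≡⟨ cong₂ ℤ._+_ (topCoeff-scale c b) (trans (cong topCoeff (zeroˡ a)) (topCoeff-0# {m})) ⟩
  c ℤ.* topCoeff b ℤ.+ 0ℤ                    ≡⟨ ℤ.+-identityʳ _ ⟩
  c ℤ.* topCoeff b                           ∎
  where open DualRing m; open ≡-Reasoning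

topCoeff-θ : ∀ {m} (x : Dual m) → topCoeff (θ x) ≡ + m ℤ.* topCoeff x
topCoeff-θ {zero}  _       = refl
topCoeff-θ {suc m} (_ , b) = begin
  topCoeff (θ b + b)                 ≡⟨ topCoeff-+ (θ b) b ⟩
  topCoeff (θ b) ℤ.+ topCoeff b      ≡⟨ cong (ℤ._+ topCoeff b) (topCoeff-θ b) ⟩
  + m ℤ.* topCoeff b ℤ.+ topCoeff b  ≡⟨ ℤ.+-comm (+ m ℤ.* topCoeff b) (topCoeff b) ⟩
  topCoeff b ℤ.+ + m ℤ.* topCoeff b  ≡⟨ ℤ.suc-* (+ m) (topCoeff b) ⟨
  + suc m ℤ.* topCoeff b             ∎
  where open ≡-Reasoning

topCoeff-homogeneous : ∀ {m d} {x : Dual m} → Homogeneous d x → d ≢ m → topCoeff x ≡ 0ℤ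
topCoeff-homogeneous {m} {d} {x} h d≢m with topCoeff x ℤ.≟ 0ℤ
... | yes t≡0 = t≡0
... | no  t≢0 = contradiction (ℤ.+-injective (ℤ.*-cancelʳ-≡ (+ d) (+ m) (topCoeff x) {{ℤ.≢-nonZero t≢0}} (begin
  + d ℤ.* topCoeff x          ≡⟨ topCoeff-scale (+ d) x ⟨
  topCoeff (fromℤ (+ d) * x)  ≡⟨ cong topCoeff h ⟨
  topCoeff (θ x)              ≡⟨ topCoeff-θ x ⟩
  + m ℤ.* topCoeff x          ∎))) d≢m
  where open ≡-Reasoning

constCoeff : ∀ {m} → Dual m → ℤ
constCoeff {zero}  x       = x
constCoeff {suc m} (a , _) = constCoeff a

constCoeff-+ : ∀ {m} (x y : Dual m) → constCoeff (x + y) ≡ constCoeff x ℤ.+ constCoeff y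
constCoeff-+ {zero}  _       _       = refl
constCoeff-+ {suc m} (a , _) (c , _) = constCoeff-+ a c

constCoeff-* : ∀ {m} (x y : Dual m) → constCoeff (x * y) ≡ constCoeff x ℤ.* constCoeff y
constCoeff-* {zero}  _       _       = refl
constCoeff-* {suc m} (a , _) (c , _) = constCoeff-* a c

constCoeff-fromℤ : ∀ {m} c → constCoeff (fromℤ {m} c) ≡ c
constCoeff-fromℤ {zero}  _ = refl
constCoeff-fromℤ {suc m} c = constCoeff-fromℤ {m} c

constCoeff-θ : ∀ {m} (x : Dual m) → constCoeff (θ x) ≡ 0ℤ
constCoeff-θ {zero}  _       = refl
constCoeff-θ {suc m} (a , _) = constCoeff-θ a

constCoeff-homogeneous : ∀ {m d} {x : Dual m} → Homogeneous (suc d) x → constCoeff x ≡ 0ℤ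
constCoeff-homogeneous {m} {d} {x} h = ℤ.*-cancelˡ-≡ (+ suc d) (constCoeff x) 0ℤ (begin
  + suc d ℤ.* constCoeff x                      ≡⟨ cong (ℤ._* constCoeff x) (constCoeff-fromℤ {m} (+ suc d)) ⟨
  constCoeff (fromℤ {m} (+ suc d)) ℤ.* constCoeff x ≡⟨ constCoeff-* (fromℤ (+ suc d)) x ⟨
  constCoeff (fromℤ (+ suc d) * x)              ≡⟨ cong constCoeff h ⟨
  constCoeff (θ x)                              ≡⟨ constCoeff-θ x ⟩
  0ℤ                                            ≡⟨ ℤ.*-zeroʳ (+ suc d) ⟨
  + suc d ℤ.* 0ℤ                                ∎)
  where open ≡-Reasoning

-- (a + b ε)⁻¹ = a⁻¹ − b a⁻² ε
inverse : ∀ {m} (x : Dual m) → constCoeff x ≡ 1ℤ → Σ[ y ∈ Dual m ] x * y ≡ 1#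
inverse {zero}  x       refl = 1ℤ , refl
inverse {suc m} (a , b) c≡1 with inverse a c≡1
... | a′ , aa′≡1 = (a′ , - (b * (a′ * a′))) , cong₂ _,_ aa′≡1 (begin
  a * - (b * (a′ * a′)) + b * a′
    ≡⟨ solve 3 (λ a b a′ → a :* :- (b :* (a′ :* a′)) :+ b :* a′ := b :* a′ :* (con 1ℤ :+ :- (a :* a′))) refl a b a′ ⟩
  b * a′ * (1# + - (a * a′))        ≡⟨ cong (λ t → b * a′ * (1# + - t)) aa′≡1 ⟩
  b * a′ * (1# + - 1#)              ≡⟨ solve 2 (λ x y → x :* (y :+ :- y) := con 0ℤ) refl (b * a′) 1# ⟩
  0#                                ∎)
  where open DualRing m; open ≡-Reasoning

-- For x = a + b ε and y = x⁻¹ = a′ + b′ ε, the ε-part of θ x * y is θ c + c with c = b a′.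
topCoeff-θ-*-inverse : ∀ {m} (x y : Dual (suc m)) → x * y ≡ 1# → + suc m DivS.∣ topCoeff (θ x * y)
topCoeff-θ-*-inverse {m} (a , b) (a′ , b′) xy≡1 = DivS.divides (topCoeff (b * a′)) (begin
  topCoeff (θ a * b′ + (θ b + b) * a′)   ≡⟨ cong topCoeff ε-part ⟩
  topCoeff (θ (b * a′) + b * a′)         ≡⟨ topCoeff-θ {suc m} (0# , b * a′) ⟩
  + suc m ℤ.* topCoeff (b * a′)          ≡⟨ ℤ.*-comm (+ suc m) (topCoeff (b * a′)) ⟩
  topCoeff (b * a′) ℤ.* + suc m          ∎)
  where
  open DualRing m
  open CommutativeRingTheory (dualRing m) using (inverse-cross-swap)
  open ≡-Reasoning
  aa′≡1 : a * a′ ≡ 1#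
  aa′≡1 = cong proj₁ xy≡1
  θa·b′≡b·θa′ : θ a * b′ ≡ b * θ a′
  θa·b′≡b·θa′ = inverse-cross-swap aa′≡1 (cong proj₂ xy≡1)
    (trans (sym (θ-* a a′)) (trans (cong θ aa′≡1) (θ-fromℤ 1ℤ)))
  ε-part : θ a * b′ + (θ b + b) * a′ ≡ θ (b * a′) + b * a′
  ε-part = begin
    θ a * b′ + (θ b + b) * a′      ≡⟨ cong (_+ (θ b + b) * a′) θa·b′≡b·θa′ ⟩
    b * θ a′ + (θ b + b) * a′      ≡⟨ solve 4 (λ b x y a′ → b :* x :+ (y :+ b) :* a′ := y :* a′ :+ b :* x :+ b :* a′)
                                             refl b (θ a′) (θ b) a′ ⟩
    θ b * a′ + b * θ a′ + b * a′   ≡⟨ cong (_+ b * a′) (θ-* b a′) ⟨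
    θ (b * a′) + b * a′            ∎

-- Newton's identities

module NewtonIdentities {m : ℕ} (f p : ℕ → Dual (suc m)) (f₀≡1 : f 0 ≡ 1#)
  (f-homogeneous : ∀ i → Homogeneous i (f i))
  (newton : ∀ k → CommutativeRingTheory.conv (dualRing (suc m)) f p 0 k ≡ - θ (f k)) where

  open CommutativeRingTheory (dualRing (suc m))
  open DualRing (suc m)
  open ≡-Reasoning

  n : ℕ
  n = suc m

  F : ℕ → Dual n
  F = partialSum f

  conv-homogeneous : ∀ k i → (∀ {j} → j ℕ.< k → Homogeneous (suc j) (p (suc j))) →
                     Homogeneous (i ℕ.+ k) (conv f p i k)
  conv-homogeneous zero    i _ = homogeneous-0# (i ℕ.+ 0)
  conv-homogeneous (suc k) i h = homogeneous-+ (homogeneous-* (f-homogeneous i) (h ℕ.≤-refl))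
    (subst (λ d → Homogeneous d (conv f p (suc i) k)) (sym (ℕ.+-suc i k))
           (conv-homogeneous k (suc i) (λ j<k → h (ℕ.m<n⇒m<1+n j<k))))

  p-suc : ∀ k → p (suc k) ≡ - θ (f (suc k)) + - conv f p 1 k
  p-suc k = ∙-cancelʳ (conv f p 1 k) _ _ (begin
    p (suc k) + conv f p 1 k              ≡⟨ cong (_+ conv f p 1 k) (*-identityˡ (p (suc k))) ⟨
    1# * p (suc k) + conv f p 1 k         ≡⟨ cong (λ c → c * p (suc k) + conv f p 1 k) f₀≡1 ⟨
    f 0 * p (suc k) + conv f p 1 k        ≡⟨ newton (suc k) ⟩
    - θ (f (suc k))                       ≡⟨ solve 2 (λ x y → :- x := :- x :+ :- y :+ y) refl (θ (f (suc k))) (conv f p 1 k) ⟩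
    - θ (f (suc k)) + - conv f p 1 k + conv f p 1 k ∎)

  p-homogeneous : ∀ k → Homogeneous (suc k) (p (suc k))
  p-homogeneous = <-rec (λ k → Homogeneous (suc k) (p (suc k))) λ k rec →
    subst (Homogeneous (suc k)) (sym (p-suc k))
      (homogeneous-+ (homogeneous-neg (θf-homogeneous k)) (homogeneous-neg (conv-homogeneous k 1 rec)))
    where
    θf-homogeneous : ∀ k → Homogeneous (suc k) (θ (f (suc k)))
    θf-homogeneous k = subst (Homogeneous (suc k)) (sym (f-homogeneous (suc k)))
                             (homogeneous-scale (+ suc k) (f-homogeneous (suc k)))

  newton-summed : ∀ K → conv F p 0 K ≡ - θ (F K)
  newton-summed zero    = newton 0
  newton-summed (suc K) = begin
    conv F p 0 (suc K)                         ≡⟨ conv-partialSum f p K ⟩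
    conv F p 0 K + conv f p 0 (suc K)          ≡⟨ cong₂ _+_ (newton-summed K) (newton (suc K)) ⟩
    - θ (F K) + - θ (f (suc K))                ≡⟨ solve 2 (λ x y → :- x :+ :- y := :- (x :+ y)) refl (θ (F K)) (θ (f (suc K))) ⟩
    - (θ (F K) + θ (f (suc K)))                ≡⟨ cong -_ (θ-+ (F K) (f (suc K))) ⟨
    - θ (F (suc K))                            ∎

  -- f i * p (suc j) is homogeneous of degree i + suc j, hence zero once that exceeds n.
  F-absorbs : ∀ d r j → n ℕ.≤ r ℕ.+ suc j → F (d ℕ.+ r) * p (suc j) ≡ F r * p (suc j)
  F-absorbs zero    r j _ = refl
  F-absorbs (suc d) r j n≤ = begin
    (F (d ℕ.+ r) + f (suc (d ℕ.+ r))) * p (suc j)              ≡⟨ distribʳ _ _ _ ⟩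
    F (d ℕ.+ r) * p (suc j) + f (suc (d ℕ.+ r)) * p (suc j)    ≡⟨ cong₂ _+_ (F-absorbs d r j n≤) fp≡0 ⟩
    F r * p (suc j) + 0#                                       ≡⟨ +-identityʳ _ ⟩
    F r * p (suc j)                                            ∎
    where
    fp≡0 : f (suc (d ℕ.+ r)) * p (suc j) ≡ 0#
    fp≡0 = homogeneous-vanishes (homogeneous-* (f-homogeneous (suc (d ℕ.+ r))) (p-homogeneous j))
             (ℕ.s≤s (ℕ.≤-trans n≤ (ℕ.+-monoˡ-≤ (suc j) (ℕ.m≤n+m r d))))

  generating-identity : partialSum⁺ p n * F n ≡ - θ (F n)
  generating-identity = begin
    partialSum⁺ p n * F n   ≡⟨ *-comm _ _ ⟩
    F n * partialSum⁺ p n   ≡⟨ conv-constantˡ F p (F n) 0 n absorbs ⟨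
    conv F p 0 n            ≡⟨ newton-summed n ⟩
    - θ (F n)               ∎
    where
    absorbs : ∀ i j → i ℕ.+ suc j ≡ n → F i * p (suc j) ≡ F n * p (suc j)
    absorbs i j i+j≡n = begin
      F i * p (suc j)               ≡⟨ F-absorbs (suc j) i j (ℕ.≤-reflexive (sym i+j≡n)) ⟨
      F (suc j ℕ.+ i) * p (suc j)   ≡⟨ cong (λ r → F r * p (suc j)) (trans (ℕ.+-comm (suc j) i) i+j≡n) ⟩
      F n * p (suc j)               ∎

  constCoeff-F : ∀ r → constCoeff (F r) ≡ 1ℤ
  constCoeff-F zero    = trans (cong constCoeff f₀≡1) (constCoeff-fromℤ {n} 1ℤ)
  constCoeff-F (suc r) = begin
    constCoeff (F r + f (suc r))                  ≡⟨ constCoeff-+ (F r) (f (suc r)) ⟩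
    constCoeff (F r) ℤ.+ constCoeff (f (suc r))   ≡⟨ cong₂ ℤ._+_ (constCoeff-F r) (constCoeff-homogeneous (f-homogeneous (suc r))) ⟩
    1ℤ                                            ∎

  topCoeff-partialSum⁺ : ∀ k → k ℕ.≤ m → topCoeff (partialSum⁺ p k) ≡ 0ℤ
  topCoeff-partialSum⁺ zero    _   = topCoeff-0# {n}
  topCoeff-partialSum⁺ (suc k) k<m = begin
    topCoeff (partialSum⁺ p k + p (suc k))                   ≡⟨ topCoeff-+ (partialSum⁺ p k) (p (suc k)) ⟩
    topCoeff (partialSum⁺ p k) ℤ.+ topCoeff (p (suc k))      ≡⟨ cong₂ ℤ._+_ (topCoeff-partialSum⁺ k (ℕ.<⇒≤ k<m))
                                                                 (topCoeff-homogeneous (p-homogeneous k) (ℕ.<⇒≢ (ℕ.s≤s k<m))) ⟩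
    0ℤ                                                       ∎

  module _ (G : Dual n) (FG≡1 : F n * G ≡ 1#) where
    P≡-θF·G : partialSum⁺ p n ≡ - (θ (F n) * G)
    P≡-θF·G = begin
      partialSum⁺ p n                 ≡⟨ *-identityʳ _ ⟨
      partialSum⁺ p n * 1#            ≡⟨ cong (partialSum⁺ p n *_) FG≡1 ⟨
      partialSum⁺ p n * (F n * G)     ≡⟨ *-assoc _ _ _ ⟨
      partialSum⁺ p n * F n * G       ≡⟨ cong (_* G) generating-identity ⟩
      - θ (F n) * G                   ≡⟨ solve 2 (λ x y → :- x :* y := :- (x :* y)) refl (θ (F n)) G ⟩
      - (θ (F n) * G)                 ∎

    topCoeff-p : topCoeff (p n) ≡ ℤ.- topCoeff (θ (F n) * G)
    topCoeff-p = begin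
      topCoeff (p n)                                  ≡⟨ ℤ.+-identityˡ _ ⟨
      0ℤ ℤ.+ topCoeff (p n)                           ≡⟨ cong (ℤ._+ topCoeff (p n)) (topCoeff-partialSum⁺ m ℕ.≤-refl) ⟨
      topCoeff (partialSum⁺ p m) ℤ.+ topCoeff (p n)   ≡⟨ topCoeff-+ (partialSum⁺ p m) (p n) ⟨
      topCoeff (partialSum⁺ p n)                      ≡⟨ cong topCoeff P≡-θF·G ⟩
      topCoeff (- (θ (F n) * G))                      ≡⟨ topCoeff-neg (θ (F n) * G) ⟩
      ℤ.- topCoeff (θ (F n) * G)                      ∎

  topCoeff-p-divisible : (+ n) ∣ topCoeff (p n)
  topCoeff-p-divisible = ∣⇒∣ᵤ (subst (+ n DivS.∣_) (sym (topCoeff-p G FG≡1))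
                                     (∣m⇒∣-m (topCoeff-θ-*-inverse (F n) G FG≡1)))
    where
    G : Dual n
    G = proj₁ (inverse (F n) (constCoeff-F n))
    FG≡1 : F n * G ≡ 1#
    FG≡1 = proj₂ (inverse (F n) (constCoeff-F n))

-- Evaluating the polynomials of Defs

evalMono : ∀ {n} → Vec ℕ n → Dual n
evalMono []                  = 1ℤ
evalMono (0 ∷ α)             = evalMono α , 0#
evalMono (1 ∷ α)             = 0# , evalMono α
evalMono (suc (suc _) ∷ α)   = 0#

eval : ∀ {n} → Poly n → Dual n
eval []            = 0#
eval ((c , α) ∷ p) = fromℤ c * evalMono α + eval p

module _ {n : ℕ} where
  open DualRing n
  open ≡-Reasoning

  eval-⊕ : ∀ (p q : Poly n) → eval (p ⊕ q) ≡ eval p + eval q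
  eval-⊕ []            q = sym (+-identityˡ (eval q))
  eval-⊕ ((c , α) ∷ p) q = trans (cong (λ t → fromℤ c * evalMono α + t) (eval-⊕ p q)) (sym (+-assoc _ _ _))

  eval-scale : ∀ c (p : Poly n) → eval (scale c p) ≡ fromℤ c * eval p
  eval-scale c []            = sym (zeroʳ (fromℤ c))
  eval-scale c ((a , α) ∷ p) = begin
    fromℤ (c ℤ.* a) * evalMono α + eval (scale c p)  ≡⟨ cong₂ (λ u v → u * evalMono α + v) (fromℤ-* c a) (eval-scale c p) ⟩
    fromℤ c * fromℤ a * evalMono α + fromℤ c * eval p
      ≡⟨ solve 4 (λ c a x p → c :* a :* x :+ c :* p := c :* (a :* x :+ p)) refl (fromℤ c) (fromℤ a) (evalMono α) (eval p) ⟩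
    fromℤ c * (fromℤ a * evalMono α + eval p)        ∎

evalMono-zipWith : ∀ {n} (α β : Vec ℕ n) → evalMono (zipWith ℕ._+_ α β) ≡ evalMono α * evalMono β
evalMono-zipWith []                []           = refl
evalMono-zipWith {suc n} (0 ∷ α)   (0 ∷ β)      = cong₂ _,_ (evalMono-zipWith α β)
  (solve 2 (λ x y → con 0ℤ := x :* con 0ℤ :+ con 0ℤ :* y) refl (evalMono α) (evalMono β))
  where open DualRing n
evalMono-zipWith {suc n} (0 ∷ α)   (1 ∷ β)      = cong₂ _,_ (sym (zeroʳ (evalMono α)))
  (trans (evalMono-zipWith α β) (solve 2 (λ x y → x :* y := x :* y :+ con 0ℤ :* con 0ℤ) refl (evalMono α) (evalMono β)))
  where open DualRing n
evalMono-zipWith {suc n} (1 ∷ α)   (0 ∷ β)      = cong₂ _,_ (sym (zeroˡ (evalMono β)))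
  (trans (evalMono-zipWith α β) (solve 2 (λ x y → x :* y := con 0ℤ :* con 0ℤ :+ x :* y) refl (evalMono α) (evalMono β)))
  where open DualRing n
evalMono-zipWith {suc n} (1 ∷ α)   (1 ∷ β)      = sym (cong₂ _,_ (zeroˡ 0#)
  (solve 2 (λ x y → con 0ℤ :* y :+ x :* con 0ℤ := con 0ℤ) refl (evalMono α) (evalMono β)))
  where open DualRing n
evalMono-zipWith {suc n} (0 ∷ α)   (suc (suc _) ∷ β) = sym (zeroʳ _)
  where open DualRing (suc n)
evalMono-zipWith {suc n} (1 ∷ α)   (suc (suc _) ∷ β) = sym (zeroʳ _)
  where open DualRing (suc n)
evalMono-zipWith {suc n} (suc (suc _) ∷ α) (_ ∷ β) = sym (zeroˡ _)
  where open DualRing (suc n)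

eval-⊗ : ∀ {n} (p q : Poly n) → eval (p ⊗ q) ≡ eval p * eval q
eval-⊗ {n} []            q = sym (zeroˡ (eval q))
  where open DualRing n
eval-⊗ {n} ((a , α) ∷ p) q = begin
  eval (List.map (λ { (b , β) → (a ℤ.* b , zipWith ℕ._+_ α β) }) q ++ (p ⊗ q))
    ≡⟨ eval-⊕ (List.map _ q) (p ⊗ q) ⟩
  eval (List.map (λ { (b , β) → (a ℤ.* b , zipWith ℕ._+_ α β) }) q) + eval (p ⊗ q)
    ≡⟨ cong₂ _+_ (eval-monomial-* q) (eval-⊗ p q) ⟩
  fromℤ a * evalMono α * eval q + eval p * eval q
    ≡⟨ distribʳ _ _ _ ⟨
  (fromℤ a * evalMono α + eval p) * eval q ∎
  where
  open DualRing n
  open ≡-Reasoning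
  eval-monomial-* : ∀ q → eval (List.map (λ { (b , β) → (a ℤ.* b , zipWith ℕ._+_ α β) }) q) ≡ fromℤ a * evalMono α * eval q
  eval-monomial-* []            = sym (zeroʳ _)
  eval-monomial-* ((b , β) ∷ q) = begin
    fromℤ (a ℤ.* b) * evalMono (zipWith ℕ._+_ α β) + eval (List.map _ q)
      ≡⟨ cong₂ _+_ (cong₂ _*_ (fromℤ-* a b) (evalMono-zipWith α β)) (eval-monomial-* q) ⟩
    fromℤ a * fromℤ b * (evalMono α * evalMono β) + fromℤ a * evalMono α * eval q
      ≡⟨ solve 5 (λ a b x y q → a :* b :* (x :* y) :+ a :* x :* q := a :* x :* (b :* y :+ q)) refl
               (fromℤ a) (fromℤ b) (evalMono α) (evalMono β) (eval q) ⟩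
    fromℤ a * evalMono α * (fromℤ b * evalMono β + eval q) ∎

topCoeff-evalMono-ones : ∀ n → topCoeff (evalMono (replicate n 1)) ≡ 1ℤ
topCoeff-evalMono-ones zero    = refl
topCoeff-evalMono-ones (suc n) = topCoeff-evalMono-ones n

topCoeff-evalMono-≢ : ∀ {n} (β : Vec ℕ n) → replicate n 1 ≢ β → topCoeff (evalMono β) ≡ 0ℤ
topCoeff-evalMono-≢ []                    ones≢β = contradiction refl ones≢β
topCoeff-evalMono-≢ {suc n} (0 ∷ β)            _ = topCoeff-0# {n}
topCoeff-evalMono-≢ {suc n} (1 ∷ β)       ones≢β = topCoeff-evalMono-≢ β (ones≢β ∘ cong (1 ∷_))
topCoeff-evalMono-≢ {suc n} (suc (suc _) ∷ β) _ = topCoeff-0# {suc n}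

topCoeff-eval : ∀ {n} (p : Poly n) → topCoeff (eval p) ≡ coeff (replicate n 1) p
topCoeff-eval {n} [] = topCoeff-0# {n}
topCoeff-eval {n} ((c , β) ∷ p) with Vec.≡-dec ℕ._≟_ (replicate n 1) β
... | yes refl = begin
  topCoeff (fromℤ c * evalMono ones + eval p)            ≡⟨ topCoeff-+ (fromℤ c * evalMono ones) (eval p) ⟩
  topCoeff (fromℤ c * evalMono ones) ℤ.+ topCoeff (eval p) ≡⟨ cong₂ ℤ._+_ (topCoeff-scale c (evalMono ones)) (topCoeff-eval p) ⟩
  c ℤ.* topCoeff (evalMono ones) ℤ.+ coeff ones p         ≡⟨ cong (λ t → c ℤ.* t ℤ.+ coeff ones p) (topCoeff-evalMono-ones n) ⟩
  c ℤ.* 1ℤ ℤ.+ coeff ones p                               ≡⟨ cong (ℤ._+ coeff ones p) (ℤ.*-identityʳ c) ⟩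
  c ℤ.+ coeff ones p                                      ∎
  where
  ones : Vec ℕ n
  ones = replicate n 1
  open ≡-Reasoning
... | no ones≢β = begin
  topCoeff (fromℤ c * evalMono β + eval p)               ≡⟨ topCoeff-+ (fromℤ c * evalMono β) (eval p) ⟩
  topCoeff (fromℤ c * evalMono β) ℤ.+ topCoeff (eval p)  ≡⟨ cong₂ ℤ._+_ (topCoeff-scale c (evalMono β)) (topCoeff-eval p) ⟩
  c ℤ.* topCoeff (evalMono β) ℤ.+ coeff ones p           ≡⟨ cong (λ t → c ℤ.* t ℤ.+ coeff ones p) (topCoeff-evalMono-≢ β ones≢β) ⟩
  c ℤ.* 0ℤ ℤ.+ coeff ones p                              ≡⟨ cong (ℤ._+ coeff ones p) (ℤ.*-zeroʳ c) ⟩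
  0ℤ ℤ.+ coeff ones p                                    ≡⟨ ℤ.+-identityˡ _ ⟩
  coeff ones p                                           ∎
  where
  ones : Vec ℕ n
  ones = replicate n 1
  open ≡-Reasoning

homogeneous-monoOf : ∀ {n} (S : Vec Bool n) → Homogeneous (size S) (evalMono (monoOf S))
homogeneous-monoOf []          = refl
homogeneous-monoOf (false ∷ S) = homogeneous-const (homogeneous-monoOf S)
homogeneous-monoOf (true ∷ S)  = homogeneous-ε (homogeneous-monoOf S)

homogeneous-subsetSum : ∀ {n} d (Ss : List (Vec Bool n)) → All (λ S → size S ≡ d) Ss →
                           Homogeneous d (eval (List.map (λ S → (+ 1 , monoOf S)) Ss))
homogeneous-subsetSum d []       []            = homogeneous-0# d
homogeneous-subsetSum d (S ∷ Ss) (refl ∷ sizes) =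
  homogeneous-+ (homogeneous-scale (+ 1) (homogeneous-monoOf S)) (homogeneous-subsetSum d Ss sizes)

module _ {n : ℕ} (U : Vec ℚ n) where
  open DualRing n
  open CommutativeRingTheory (dualRing n) using (conv)
  open ≡-Reasoning

  ρe-homogeneous : ∀ i → Homogeneous i (eval (ρe U i))
  ρe-homogeneous i = homogeneous-subsetSum i _
    (All.map (λ {S} → size≡i {S}) (all-filter (λ S → T? (selected S)) (allSubsets n)))
    where
    selected : Vec Bool n → Bool
    selected S = isIndependent U S ∧ ⌊ size S ℕ.≟ i ⌋
    size≡i : ∀ {S} → T (selected S) → size S ≡ i
    size≡i {S} t = toWitness (proj₂ (Equivalence.to (Bool.T-∧ {isIndependent U S}) t))

  f : ℕ → Dual n
  f zero    = 1#
  f (suc i) = fromℤ (sgn (suc i)) * eval (ρe U (suc i))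

  π : ℕ → Dual n
  π k = eval (ρm U k)

  f-homogeneous : ∀ i → Homogeneous i (f i)
  f-homogeneous zero    = homogeneous-1#
  f-homogeneous (suc i) = homogeneous-scale (sgn (suc i)) (ρe-homogeneous (suc i))

  newtonSum : ℕ → List (Poly n) → Poly n
  newtonSum i []       = []
  newtonSum i (q ∷ qs) = scale (sgn (ℕ.pred i)) (ρe U i ⊗ q) ⊕ newtonSum (suc i) qs

  newtonSum-unique : (st : ℕ → List (Poly n) → Poly n) → (∀ i → st i [] ≡ []) →
    (∀ i q qs → st i (q ∷ qs) ≡ scale (sgn (ℕ.pred i)) (ρe U i ⊗ q) ⊕ st (suc i) qs) →
    ∀ i qs → st i qs ≡ newtonSum i qs
  newtonSum-unique st nil cons i []       = nil i
  newtonSum-unique st nil cons i (q ∷ qs) =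
    trans (cons i q qs) (cong (scale (sgn (ℕ.pred i)) (ρe U i ⊗ q) ⊕_) (newtonSum-unique st nil cons (suc i) qs))

  -- The Newton sum inside ρpRev is local to Defs and cannot be named. With-abstracting its
  -- arguments (ρe U (suc k) first, since its normal form contains further 1s) turns the call
  -- into a pattern, so unification solves the function argument of newtonSum-unique.
  ρm-suc : ∀ k → ρm U (suc k) ≡ newtonSum 1 (ρpRev U k) ⊕ scale (sgn k ℤ.* + suc k) (ρe U (suc k))
  ρm-suc k with 1 | ρe U (suc k) | ρpRev U k | newtonSum-unique _ (λ _ → refl) (λ _ _ _ → refl)
  ... | i | E | qs | agrees = cong (_⊕ scale (sgn k ℤ.* + suc k) E) (agrees i qs)

  eval-newtonSum : ∀ k i → eval (newtonSum (suc i) (ρpRev U k)) ≡ - conv f π (suc i) k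
  eval-newtonSum zero    i = sym ε⁻¹≈ε
  eval-newtonSum (suc k) i = begin
    eval (scale (sgn i) (ρe U (suc i) ⊗ ρm U (suc k)) ⊕ newtonSum (suc (suc i)) (ρpRev U k))
      ≡⟨ eval-⊕ (scale (sgn i) (ρe U (suc i) ⊗ ρm U (suc k))) (newtonSum (suc (suc i)) (ρpRev U k)) ⟩
    eval (scale (sgn i) (ρe U (suc i) ⊗ ρm U (suc k))) + eval (newtonSum (suc (suc i)) (ρpRev U k))
      ≡⟨ cong₂ _+_ (trans (eval-scale (sgn i) (ρe U (suc i) ⊗ ρm U (suc k)))
                          (cong (fromℤ (sgn i) *_) (eval-⊗ (ρe U (suc i)) (ρm U (suc k)))))
                   (eval-newtonSum k (suc i)) ⟩
    fromℤ (sgn i) * (e * π (suc k)) + - conv f π (suc (suc i)) k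
      ≡⟨ solve 4 (λ s e p c → s :* (e :* p) :+ :- c := :- (:- s :* e :* p :+ c)) refl
               (fromℤ (sgn i)) e (π (suc k)) (conv f π (suc (suc i)) k) ⟩
    - (- fromℤ (sgn i) * e * π (suc k) + conv f π (suc (suc i)) k)
      ≡⟨ cong (λ s → - (s * e * π (suc k) + conv f π (suc (suc i)) k)) (fromℤ-neg (sgn i)) ⟨
    - (f (suc i) * π (suc k) + conv f π (suc (suc i)) k) ∎
    where
    e : Dual n
    e = eval (ρe U (suc i))

  π-suc : ∀ k → π (suc k) ≡ - conv f π 1 k + fromℤ (sgn k ℤ.* + suc k) * eval (ρe U (suc k))
  π-suc k = begin
    eval (ρm U (suc k))                                ≡⟨ cong eval (ρm-suc k) ⟩
    eval (newtonSum 1 (ρpRev U k) ⊕ scale s (ρe U (suc k)))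
      ≡⟨ eval-⊕ (newtonSum 1 (ρpRev U k)) (scale s (ρe U (suc k))) ⟩
    eval (newtonSum 1 (ρpRev U k)) + eval (scale s (ρe U (suc k)))
      ≡⟨ cong₂ _+_ (eval-newtonSum k 0) (eval-scale s (ρe U (suc k))) ⟩
    - conv f π 1 k + fromℤ s * eval (ρe U (suc k))     ∎
    where
    s : ℤ
    s = sgn k ℤ.* + suc k

  newton : ∀ k → conv f π 0 k ≡ - θ (f k)
  newton zero    = sym (trans (cong -_ (θ-fromℤ 1ℤ)) ε⁻¹≈ε)
  newton (suc k) = begin
    1# * π (suc k) + conv f π 1 k
      ≡⟨ cong (λ t → 1# * t + conv f π 1 k) (π-suc k) ⟩
    1# * (- conv f π 1 k + fromℤ (sgn k ℤ.* + suc k) * e) + conv f π 1 k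
      ≡⟨ cong (λ t → 1# * (- conv f π 1 k + t * e) + conv f π 1 k) (fromℤ-* (sgn k) (+ suc k)) ⟩
    1# * (- conv f π 1 k + fromℤ (sgn k) * fromℤ (+ suc k) * e) + conv f π 1 k
      ≡⟨ solve 4 (λ c s d e → con 1ℤ :* (:- c :+ s :* d :* e) :+ c := :- (d :* (:- s :* e))) refl
               (conv f π 1 k) (fromℤ (sgn k)) (fromℤ (+ suc k)) e ⟩
    - (fromℤ (+ suc k) * (- fromℤ (sgn k) * e))
      ≡⟨ cong (λ s → - (fromℤ (+ suc k) * (s * e))) (fromℤ-neg (sgn k)) ⟨
    - (fromℤ (+ suc k) * f (suc k))
      ≡⟨ cong -_ (f-homogeneous (suc k)) ⟨
    - θ (f (suc k)) ∎
    where
    e : Dual n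
    e = eval (ρe U (suc k))

corollary3p3 : (n : ℕ) → 1 ≤ n → (U : Vec ℚ n) → Distinct U →
    (+ n) ∣ mU U
corollary3p3 (suc m) _ U _ = subst (+ suc m ∣_) (topCoeff-eval (ρm U (suc m)))
  (NewtonIdentities.topCoeff-p-divisible (f U) (π U) refl (f-homogeneous U) (newton U))
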